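{- Let ${\bf n}$ be the fixed point starting with $0$ of the morphism $0\mapsto01$, $1\mapsto2$, $2\mapsto0$. For every $i\ge0$, the number of distinct factors of length $i$ of ${\bf n}$ is $2i+1$. -}

module Defs where

open import Data.Nat using (ℕ; zero; suc; _+_)
open import Data.Fin using (Fin; zero; suc; toℕ)
open import Data.List using (List; []; _∷_; concatMap)
open import Data.Vec using (Vec; tabulate)

Letter : Set
Letter = Fin 3

σ : Letter → List Letter
σ zero             = zero ∷ suc zero ∷ []
σ (suc zero)       = suc (suc zero) ∷ []
σ (suc (suc zero)) = zero ∷ []

σ* : List Letter → List Letter
σ* = concatMap σ

σ^_[0] : ℕ → List Letter
σ^ zero [0]  = zero ∷ []
σ^ suc k [0] = σ* (σ^ k [0])

-- Position lookup in a finite word (default 0 out of range; only used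
-- in range, since |σ^(i+1)(0)| ≥ i+2 > i).
at : List Letter → ℕ → Letter
at []       _       = zero
at (x ∷ _)  zero    = x
at (_ ∷ xs) (suc i) = at xs i

-- The fixed point 𝐧 = lim σ^k(0) starting with 0: its i-th letter is the
-- i-th letter of the prefix σ^(i+1)(0) (σ^k(0) is a prefix of σ^(k+1)(0)).
𝐧 : ℕ → Letter
𝐧 i = at (σ^ suc i [0]) i

factor : (j i : ℕ) → Vec Letter i
factor j i = tabulate (λ k → 𝐧 (j + toℕ k))

{-# OPTIONS --safe #-}

-- A factor w of 𝐧 is left special if two different letters a, b can precede it.
-- Every left special factor is a prefix of 𝐧: a factor beginning with 1 or 2, or
-- with 00 or 02, has a forced predecessor, and a left special factor beginning
-- with 01 desubstitutes (every 0 of 𝐧 starts a block σ(x), whose last letter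
-- determines x) to a shorter left special factor, whose image is again a prefix.
-- Conversely every prefix can be preceded by each of the three letters. Hence
-- among the factors of length i exactly one (the prefix) has three left
-- extensions and all others have one, so the count grows by 2 at each length.

module Submission where

open import Defs
open import Data.Empty using (⊥-elim)
open import Data.Fin using (zero; suc; toℕ; _≟_)
open import Data.List using (List; []; _∷_; _++_; _∷ʳ_; [_]; length; initLast; _∷ʳ′_)
open import Data.List.Membership.Propositional using (_∈_; _∉_)
open import Data.List.Membership.Propositional.Properties using (∈-++⁺ˡ; ∈-++⁺ʳ; ∈-++⁻)
open import Data.List.Properties
  using ( concatMap-++; ++-assoc; ++-identityʳ; ++-identityʳ-unique; length-++
        ; ∷-injectiveˡ; ∷-injectiveʳ)
open import Data.List.Relation.Binary.Disjoint.Propositional using (Disjoint)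
open import Data.List.Relation.Unary.All as All using (All; []; _∷_)
open import Data.List.Relation.Unary.Any using (here; there)
open import Data.List.Relation.Unary.Linked as Linked using (Linked; []; [-]; _∷_)
open import Data.List.Relation.Unary.Unique.Propositional using (Unique; []; _∷_)
import Data.List.Relation.Unary.Unique.Propositional.Properties as Unique
open import Data.Nat using (ℕ; zero; suc; _+_; _*_; _≤_; _<_; z≤n; s≤s)
open import Data.Nat.Induction using (<-wellFounded)
open import Data.Nat.Properties
  using ( ≤-reflexive; ≤-trans; ≤-<-trans; <-trans; <⇒≤; n≤1+n; m<m+n
        ; +-comm; +-suc; +-identityʳ; *-suc; module ≤-Reasoning)
open import Data.Product using (Σ; ∃; ∃₂; ∃-syntax; _×_; _,_; proj₁; proj₂)
open import Data.Sum using (_⊎_; inj₁; inj₂)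
open import Data.Vec as Vec using (Vec; []; _∷_; toList)
open import Data.Vec.Properties using (tabulate-cong; ≡-dec)
open import Function using (_∘_)
open import Function.Bundles using (_⇔_; mk⇔; Equivalence)
import Function.Properties.Equivalence as ⇔
open import Induction.WellFounded using (WellFounded; WfRec)
import Induction.WellFounded as WF
import Relation.Binary.Construct.On as On
open import Relation.Binary.PropositionalEquality hiding ([_])
open import Relation.Nullary using (¬_; yes; no)

pattern 𝟎 = zero
pattern 𝟏 = suc zero
pattern 𝟐 = suc (suc zero)

Word : Set
Word = List Letter

length-∷ʳ : ∀ {A : Set} (xs : List A) x → length (xs ∷ʳ x) ≡ suc (length xs)
length-∷ʳ xs x = trans (length-++ xs) (+-comm (length xs) 1)

σ*-++ : ∀ u v → σ* (u ++ v) ≡ σ* u ++ σ* v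
σ*-++ = concatMap-++ σ

σ*-nonempty : ∀ x u → ∃₂ λ y v → σ* (x ∷ u) ≡ y ∷ v
σ*-nonempty 𝟎 u = 𝟎 , 𝟏 ∷ σ* u , refl
σ*-nonempty 𝟏 u = 𝟐 , σ* u , refl
σ*-nonempty 𝟐 u = 𝟎 , σ* u , refl

length-σ* : ∀ u → length u ≤ length (σ* u)
length-σ* []      = z≤n
length-σ* (𝟎 ∷ u) = s≤s (≤-trans (length-σ* u) (n≤1+n _))
length-σ* (𝟏 ∷ u) = s≤s (length-σ* u)
length-σ* (𝟐 ∷ u) = s≤s (length-σ* u)

length-σ*-𝟎∷ : ∀ v → length (𝟎 ∷ v) < length (σ* (𝟎 ∷ v))
length-σ*-𝟎∷ v = s≤s (s≤s (length-σ* v))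

σ^[0]-grows : ∀ k → ∃₂ λ x r → σ^ suc k [0] ≡ σ^ k [0] ++ x ∷ r
σ^[0]-grows zero = 𝟏 , [] , refl
σ^[0]-grows (suc k) with σ^[0]-grows k
... | x , r , eq with σ*-nonempty x r
... | y , v , eq′ = y , v , (begin
  σ* (σ^ suc k [0])           ≡⟨ cong σ* eq ⟩
  σ* (σ^ k [0] ++ x ∷ r)      ≡⟨ σ*-++ (σ^ k [0]) (x ∷ r) ⟩
  σ^ suc k [0] ++ σ* (x ∷ r)  ≡⟨ cong (σ^ suc k [0] ++_) eq′ ⟩
  σ^ suc k [0] ++ y ∷ v       ∎)
  where open ≡-Reasoning

σ^[0]-prefix : ∀ k d → ∃ λ r → σ^ d + k [0] ≡ σ^ k [0] ++ r
σ^[0]-prefix k zero = [] , sym (++-identityʳ _)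
σ^[0]-prefix k (suc d) with σ^[0]-prefix k d | σ^[0]-grows (d + k)
... | r , eq | x , r′ , eq′ =
  r ++ x ∷ r′ , trans eq′ (trans (cong (_++ x ∷ r′) eq) (++-assoc (σ^ k [0]) r (x ∷ r′)))

σ^[0]-length : ∀ k → k < length (σ^ k [0])
σ^[0]-length zero = s≤s z≤n
σ^[0]-length (suc k) with σ^[0]-grows k
... | x , r , eq = begin-strict
  suc k                               ≤⟨ σ^[0]-length k ⟩
  length (σ^ k [0])                   <⟨ m<m+n _ (s≤s z≤n) ⟩
  length (σ^ k [0]) + length (x ∷ r)  ≡⟨ sym (length-++ (σ^ k [0])) ⟩
  length (σ^ k [0] ++ x ∷ r)          ≡⟨ cong length (sym eq) ⟩
  length (σ^ suc k [0])               ∎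
  where open ≤-Reasoning

at-++ : ∀ {m} xs ys → m < length xs → at (xs ++ ys) m ≡ at xs m
at-++ {zero}  (x ∷ xs) ys _         = refl
at-++ {suc m} (x ∷ xs) ys (s≤s m<n) = at-++ xs ys m<n

at-length : ∀ p {x s} → at (p ++ x ∷ s) (length p) ≡ x
at-length []      = refl
at-length (_ ∷ p) = at-length p

-- 𝐧 m is read off σ^ (1 + m) [0]; it and σ^ k [0] are both prefixes of σ^ (1 + m + k) [0].
𝐧-at : ∀ k p {x s} → σ^ k [0] ≡ p ++ x ∷ s → 𝐧 (length p) ≡ x
𝐧-at k p {x} {s} eq
  with σ^[0]-prefix k (suc (length p)) | σ^[0]-prefix (suc (length p)) k
... | r , eq₁ | r′ , eq₂ = begin
  at (σ^ suc m [0]) m        ≡⟨ sym (at-++ (σ^ suc m [0]) r′ m<) ⟩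
  at (σ^ suc m [0] ++ r′) m  ≡⟨ cong (λ w → at w m) (trans (sym eq₂) (cong σ^_[0] (+-comm k (suc m)))) ⟩
  at (σ^ suc m + k [0]) m    ≡⟨ cong (λ w → at w m) (trans eq₁ (cong (_++ r) eq)) ⟩
  at ((p ++ x ∷ s) ++ r) m   ≡⟨ cong (λ w → at w m) (++-assoc p (x ∷ s) r) ⟩
  at (p ++ x ∷ s ++ r) m     ≡⟨ at-length p ⟩
  x                          ∎
  where
  m = length p
  m< : m < length (σ^ suc m [0])
  m< = ≤-<-trans (n≤1+n m) (σ^[0]-length (suc m))
  open ≡-Reasoning

factor-suc : ∀ j i → factor j (suc i) ≡ 𝐧 j ∷ factor (suc j) i
factor-suc j i = cong₂ _∷_ (cong 𝐧 (+-identityʳ j)) (tabulate-cong λ t → cong 𝐧 (+-suc j (toℕ t)))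

factor-at : ∀ k {i} p (u : Vec Letter i) {s} →
            σ^ k [0] ≡ p ++ toList u ++ s → factor (length p) i ≡ u
factor-at k p []                 eq = refl
factor-at k {suc i} p (x ∷ u) {s} eq = begin
  factor (length p) (suc i)               ≡⟨ factor-suc (length p) i ⟩
  𝐧 (length p) ∷ factor (suc (length p)) i ≡⟨ cong₂ _∷_ (𝐧-at k p eq) rest ⟩
  x ∷ u                                   ∎
  where
  open ≡-Reasoning
  rest : factor (suc (length p)) i ≡ u
  rest = subst (λ j → factor j i ≡ u) (length-∷ʳ p x)
           (factor-at k (p ∷ʳ x) u (trans eq (sym (++-assoc p [ x ] (toList u ++ s)))))

vec-prefix : ∀ {A : Set} i (xs : List A) → i ≤ length xs → ∃₂ λ (u : Vec A i) s → xs ≡ toList u ++ s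
vec-prefix zero    xs       _         = [] , xs , refl
vec-prefix (suc i) (x ∷ xs) (s≤s i≤n) with vec-prefix i xs i≤n
... | u , s , eq = x ∷ u , s , cong (x ∷_) eq

vec-infix : ∀ {A : Set} j i (xs : List A) → j + i ≤ length xs →
            ∃₂ λ p (u : Vec A i) → ∃ λ s → length p ≡ j × xs ≡ p ++ toList u ++ s
vec-infix zero    i xs       le with vec-prefix i xs le
... | u , s , eq = [] , u , s , refl , eq
vec-infix (suc j) i (x ∷ xs) (s≤s le) with vec-infix j i xs le
... | p , u , s , lp , eq = x ∷ p , u , s , cong suc lp , cong (x ∷_) eq

IsFactor : Word → Set
IsFactor w = ∃[ k ] ∃₂ λ p s → σ^ k [0] ≡ p ++ w ++ s

IsPrefix : Word → Set
IsPrefix w = ∃[ k ] ∃ λ s → σ^ k [0] ≡ w ++ s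

isFactor⇔factor : ∀ {i} (u : Vec Letter i) → IsFactor (toList u) ⇔ ∃ λ j → factor j i ≡ u
isFactor⇔factor {i} u = mk⇔ (λ (k , p , s , eq) → length p , factor-at k p u eq) from
  where
  from : ∃ (λ j → factor j i ≡ u) → IsFactor (toList u)
  from (j , refl) with vec-infix j i (σ^ j + i [0]) (<⇒≤ (σ^[0]-length (j + i)))
  ... | p , v , s , refl , eq =
    j + i , p , s , subst (λ t → σ^ j + i [0] ≡ p ++ toList t ++ s) (sym (factor-at (j + i) p v eq)) eq

prefix-isPrefix : ∀ i → IsPrefix (toList (factor 0 i))
prefix-isPrefix i with vec-prefix i (σ^ i [0]) (<⇒≤ (σ^[0]-length i))
... | u , s , eq = i , s , subst (λ v → σ^ i [0] ≡ toList v ++ s) (sym (factor-at i [] u eq)) eq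

isPrefix⇒≡prefix : ∀ {i} (u : Vec Letter i) → IsPrefix (toList u) → u ≡ factor 0 i
isPrefix⇒≡prefix u (k , s , eq) = sym (factor-at k [] u eq)

IsPrefix⇒IsFactor : ∀ {w} → IsPrefix w → IsFactor w
IsPrefix⇒IsFactor (k , s , eq) = k , [] , s , eq

IsFactor-σ* : ∀ {w} → IsFactor w → IsFactor (σ* w)
IsFactor-σ* {w} (k , p , s , eq) = suc k , σ* p , σ* s , (begin
  σ* (σ^ k [0])              ≡⟨ cong σ* eq ⟩
  σ* (p ++ w ++ s)           ≡⟨ σ*-++ p (w ++ s) ⟩
  σ* p ++ σ* (w ++ s)        ≡⟨ cong (σ* p ++_) (σ*-++ w s) ⟩
  σ* p ++ σ* w ++ σ* s       ∎)
  where open ≡-Reasoning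

IsPrefix-σ* : ∀ {w} → IsPrefix w → IsPrefix (σ* w)
IsPrefix-σ* {w} (k , s , eq) = suc k , σ* s , trans (cong σ* eq) (σ*-++ w s)

IsFactor-++⁻ˡ : ∀ v {w} → IsFactor (v ++ w) → IsFactor v
IsFactor-++⁻ˡ v {w} (k , p , s , eq) = k , p , w ++ s , trans eq (cong (p ++_) (++-assoc v w s))

IsFactor-++⁻ʳ : ∀ v {w} → IsFactor (v ++ w) → IsFactor w
IsFactor-++⁻ʳ v {w} (k , p , s , eq) =
  k , p ++ v , s , trans eq (trans (cong (p ++_) (++-assoc v w s)) (sym (++-assoc p v (w ++ s))))

IsPrefix-++⁻ˡ : ∀ v {w} → IsPrefix (v ++ w) → IsPrefix v
IsPrefix-++⁻ˡ v {w} (k , s , eq) = k , w ++ s , trans eq (++-assoc v w s)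

IsFactor-∷ʳ : ∀ v {c r} → IsFactor (v ++ c ∷ r) → IsFactor (v ∷ʳ c)
IsFactor-∷ʳ v {c} {r} f = IsFactor-++⁻ˡ (v ∷ʳ c) (subst IsFactor (sym (++-assoc v [ c ] r)) f)

IsPrefix-∷ʳ : ∀ {v} → IsPrefix v → ∃ λ d → IsPrefix (v ∷ʳ d)
IsPrefix-∷ʳ {v} (k , d ∷ s , eq) = d , k , s , trans eq (sym (++-assoc v [ d ] s))
IsPrefix-∷ʳ {v} (k , [] , eq) with σ^[0]-grows k
... | x , r , eq′ =
  x , suc k , r , trans eq′ (trans (cong (_++ x ∷ r) (trans eq (++-identityʳ v))) (sym (++-assoc v [ x ] r)))

IsFactor-σ^suc : ∀ {w} → IsFactor w → ∃[ k ] ∃₂ λ p s → σ* (σ^ k [0]) ≡ p ++ w ++ s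
IsFactor-σ^suc {w} (k , p , s , eq) with σ^[0]-grows k
... | x , r , eq′ = k , p , s ++ x ∷ r , (begin
  σ^ suc k [0]                ≡⟨ eq′ ⟩
  σ^ k [0] ++ x ∷ r           ≡⟨ cong (_++ x ∷ r) eq ⟩
  (p ++ w ++ s) ++ x ∷ r      ≡⟨ ++-assoc p (w ++ s) (x ∷ r) ⟩
  p ++ (w ++ s) ++ x ∷ r      ≡⟨ cong (p ++_) (++-assoc w s (x ∷ r)) ⟩
  p ++ w ++ s ++ x ∷ r        ∎)
  where open ≡-Reasoning

IsFactor⇒IsPrefix⊎∷ : ∀ {w} → IsFactor w → IsPrefix w ⊎ ∃ λ a → IsFactor (a ∷ w)
IsFactor⇒IsPrefix⊎∷ (k , p , s , eq) with initLast p
... | []      = inj₁ (k , s , eq)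
... | p′ ∷ʳ′ a = inj₂ (a , k , p′ , s , trans eq (++-assoc p′ [ a ] _))

-- 0 σ^(k+1)(0) = σ(2 σ^k(0)),  2 σ^(k+1)(0) = σ(1 σ^k(0)),  0 1 σ^(k+1)(0) = σ(0 σ^k(0)).
∷σ^[0]-isFactor : ∀ k a → IsFactor (a ∷ σ^ k [0])
∷σ^[0]-isFactor zero    𝟎 = 4 , 𝟎 ∷ 𝟏 ∷ 𝟐 ∷ [] , 𝟏 ∷ [] , refl
∷σ^[0]-isFactor zero    𝟏 = 5 , 𝟎 ∷ 𝟏 ∷ 𝟐 ∷ 𝟎 ∷ 𝟎 ∷ [] , 𝟏 ∷ 𝟐 ∷ [] , refl
∷σ^[0]-isFactor zero    𝟐 = 3 , 𝟎 ∷ 𝟏 ∷ [] , [] , refl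
∷σ^[0]-isFactor (suc k) 𝟎 = IsFactor-σ* (∷σ^[0]-isFactor k 𝟐)
∷σ^[0]-isFactor (suc k) 𝟏 = IsFactor-++⁻ʳ [ 𝟎 ] (IsFactor-σ* (∷σ^[0]-isFactor k 𝟎))
∷σ^[0]-isFactor (suc k) 𝟐 = IsFactor-σ* (∷σ^[0]-isFactor k 𝟏)

IsPrefix⇒∷-isFactor : ∀ {w} → IsPrefix w → ∀ a → IsFactor (a ∷ w)
IsPrefix⇒∷-isFactor {w} (k , s , eq) a =
  IsFactor-++⁻ˡ (a ∷ w) (subst (IsFactor ∘ (a ∷_)) eq (∷σ^[0]-isFactor k a))

data Adjacent : Letter → Letter → Set where
  𝟎𝟎 : Adjacent 𝟎 𝟎
  𝟎𝟏 : Adjacent 𝟎 𝟏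
  𝟏𝟎 : Adjacent 𝟏 𝟎
  𝟏𝟐 : Adjacent 𝟏 𝟐
  𝟐𝟎 : Adjacent 𝟐 𝟎

Linked-σ* : ∀ {u} → Linked Adjacent u → Linked Adjacent (σ* u)
Linked-σ* []          = []
Linked-σ* ([-] {𝟎})   = 𝟎𝟏 ∷ [-]
Linked-σ* ([-] {𝟏})   = [-]
Linked-σ* ([-] {𝟐})   = [-]
Linked-σ* (𝟎𝟎 ∷ l)    = 𝟎𝟏 ∷ 𝟏𝟎 ∷ Linked-σ* l
Linked-σ* (𝟎𝟏 ∷ l)    = 𝟎𝟏 ∷ 𝟏𝟐 ∷ Linked-σ* l
Linked-σ* (𝟏𝟎 ∷ l)    = 𝟐𝟎 ∷ Linked-σ* l
Linked-σ* (𝟏𝟐 ∷ l)    = 𝟐𝟎 ∷ Linked-σ* l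
Linked-σ* (𝟐𝟎 ∷ l)    = 𝟎𝟎 ∷ Linked-σ* l

Linked-σ^[0] : ∀ k → Linked Adjacent (σ^ k [0])
Linked-σ^[0] zero    = [-]
Linked-σ^[0] (suc k) = Linked-σ* (Linked-σ^[0] k)

Linked-++⁻ʳ : ∀ {A : Set} {R : A → A → Set} xs {ys} → Linked R (xs ++ ys) → Linked R ys
Linked-++⁻ʳ []       l = l
Linked-++⁻ʳ (x ∷ xs) l = Linked-++⁻ʳ xs (Linked.tail l)

IsFactor⇒Adjacent : ∀ {a b w} → IsFactor (a ∷ b ∷ w) → Adjacent a b
IsFactor⇒Adjacent (k , p , s , eq) =
  Linked.head (Linked-++⁻ʳ p (subst (Linked Adjacent) eq (Linked-σ^[0] k)))

predecessor-𝟏 : ∀ {a w} → IsFactor (a ∷ 𝟏 ∷ w) → a ≡ 𝟎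
predecessor-𝟏 f with IsFactor⇒Adjacent f
... | 𝟎𝟏 = refl

predecessor-𝟐 : ∀ {a w} → IsFactor (a ∷ 𝟐 ∷ w) → a ≡ 𝟏
predecessor-𝟐 f with IsFactor⇒Adjacent f
... | 𝟏𝟐 = refl

∷ʳ𝟏-isFactor⇒∷ʳ𝟐-¬isFactor : ∀ x v → IsFactor ((x ∷ v) ∷ʳ 𝟏) → ¬ IsFactor ((x ∷ v) ∷ʳ 𝟐)
∷ʳ𝟏-isFactor⇒∷ʳ𝟐-¬isFactor x []      f₁ f₂ with predecessor-𝟏 f₁ | predecessor-𝟐 f₂
... | refl | ()
∷ʳ𝟏-isFactor⇒∷ʳ𝟐-¬isFactor x (y ∷ v) f₁ f₂ =
  ∷ʳ𝟏-isFactor⇒∷ʳ𝟐-¬isFactor y v (IsFactor-++⁻ʳ [ x ] f₁) (IsFactor-++⁻ʳ [ x ] f₂)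

lastσ : Letter → Letter
lastσ 𝟎 = 𝟏
lastσ 𝟏 = 𝟐
lastσ 𝟐 = 𝟎

σ*≢𝟏∷ : ∀ u {t} → σ* u ≢ 𝟏 ∷ t
σ*≢𝟏∷ []      ()
σ*≢𝟏∷ (𝟎 ∷ _) ()
σ*≢𝟏∷ (𝟏 ∷ _) ()
σ*≢𝟏∷ (𝟐 ∷ _) ()

σ*-split-before-𝟎 : ∀ u p {a z} → σ* u ≡ p ++ a ∷ 𝟎 ∷ z →
                    ∃₂ λ u₁ x → ∃ λ u₂ → u ≡ u₁ ++ x ∷ u₂ × lastσ x ≡ a × σ* u₂ ≡ 𝟎 ∷ z
σ*-split-before-𝟎 []      []          ()
σ*-split-before-𝟎 []      (_ ∷ _)     ()
σ*-split-before-𝟎 (𝟎 ∷ u) []          ()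
σ*-split-before-𝟎 (𝟎 ∷ u) (_ ∷ [])    eq =
  [] , 𝟎 , u , refl , ∷-injectiveˡ (∷-injectiveʳ eq) , ∷-injectiveʳ (∷-injectiveʳ eq)
σ*-split-before-𝟎 (𝟎 ∷ u) (_ ∷ _ ∷ p) eq with σ*-split-before-𝟎 u p (∷-injectiveʳ (∷-injectiveʳ eq))
... | u₁ , x , u₂ , refl , l , e = 𝟎 ∷ u₁ , x , u₂ , refl , l , e
σ*-split-before-𝟎 (𝟏 ∷ u) []          eq = [] , 𝟏 , u , refl , ∷-injectiveˡ eq , ∷-injectiveʳ eq
σ*-split-before-𝟎 (𝟏 ∷ u) (_ ∷ p)     eq with σ*-split-before-𝟎 u p (∷-injectiveʳ eq)
... | u₁ , x , u₂ , refl , l , e = 𝟏 ∷ u₁ , x , u₂ , refl , l , e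
σ*-split-before-𝟎 (𝟐 ∷ u) []          eq = [] , 𝟐 , u , refl , ∷-injectiveˡ eq , ∷-injectiveʳ eq
σ*-split-before-𝟎 (𝟐 ∷ u) (_ ∷ p)     eq with σ*-split-before-𝟎 u p (∷-injectiveʳ eq)
... | u₁ , x , u₂ , refl , l , e = 𝟐 ∷ u₁ , x , u₂ , refl , l , e

-- Greedy decoding of w into blocks 01 = σ(0), 2 = σ(1), 0 = σ(2); it stops at a
-- final 0 (which may be the beginning of a block 01) and at any 1 that does not
-- follow a 0.
σ⁻¹ : Word → Word
σ⁻¹ []          = []
σ⁻¹ (𝟎 ∷ [])    = []
σ⁻¹ (𝟎 ∷ 𝟏 ∷ w) = 𝟎 ∷ σ⁻¹ w
σ⁻¹ (𝟎 ∷ 𝟎 ∷ w) = 𝟐 ∷ σ⁻¹ (𝟎 ∷ w)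
σ⁻¹ (𝟎 ∷ 𝟐 ∷ w) = 𝟐 ∷ 𝟏 ∷ σ⁻¹ w
σ⁻¹ (𝟏 ∷ _)     = []
σ⁻¹ (𝟐 ∷ w)     = 𝟏 ∷ σ⁻¹ w

-- How a word w read inside σ*(σ⁻¹ w ++ r) ends: exactly at a block boundary, or
-- one letter into the block σ(c) of the next letter c.
data Parse (w : Word) : Word → Set where
  exact : ∀ {r}   → w ≡ σ* (σ⁻¹ w) → Parse w r
  cut   : ∀ {c r} → w ≡ σ* (σ⁻¹ w) ∷ʳ 𝟎 → c ≢ 𝟏 → Parse w (c ∷ r)

exact≢cut : ∀ {w} → w ≡ σ* (σ⁻¹ w) → ¬ w ≡ σ* (σ⁻¹ w) ∷ʳ 𝟎
exact≢cut {w} e e′ with ++-identityʳ-unique (σ* (σ⁻¹ w)) (trans (sym e) e′)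
... | ()

Parse-σ*-++ : ∀ v {w r} → σ⁻¹ (σ* v ++ w) ≡ v ++ σ⁻¹ w → Parse w r → Parse (σ* v ++ w) r
Parse-σ*-++ v {w} eq (exact e) = exact (begin
  σ* v ++ w                 ≡⟨ cong (σ* v ++_) e ⟩
  σ* v ++ σ* (σ⁻¹ w)        ≡⟨ sym (σ*-++ v (σ⁻¹ w)) ⟩
  σ* (v ++ σ⁻¹ w)           ≡⟨ cong σ* (sym eq) ⟩
  σ* (σ⁻¹ (σ* v ++ w))      ∎)
  where open ≡-Reasoning
Parse-σ*-++ v {w} eq (cut e c≢𝟏) = cut (begin
  σ* v ++ w                      ≡⟨ cong (σ* v ++_) e ⟩
  σ* v ++ σ* (σ⁻¹ w) ∷ʳ 𝟎        ≡⟨ sym (++-assoc (σ* v) (σ* (σ⁻¹ w)) [ 𝟎 ]) ⟩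
  (σ* v ++ σ* (σ⁻¹ w)) ∷ʳ 𝟎      ≡⟨ cong (_∷ʳ 𝟎) (sym (σ*-++ v (σ⁻¹ w))) ⟩
  σ* (v ++ σ⁻¹ w) ∷ʳ 𝟎           ≡⟨ cong ((_∷ʳ 𝟎) ∘ σ*) (sym eq) ⟩
  σ* (σ⁻¹ (σ* v ++ w)) ∷ʳ 𝟎      ∎) c≢𝟏
  where open ≡-Reasoning

parse : ∀ w u {s} → σ* u ≡ w ++ s → ∃ λ r → u ≡ σ⁻¹ w ++ r × Parse w r
parse []          u       _  = u , refl , exact refl
parse (𝟎 ∷ [])    []      ()
parse (𝟎 ∷ [])    (𝟎 ∷ u) _  = 𝟎 ∷ u , refl , cut refl λ ()
parse (𝟎 ∷ [])    (𝟏 ∷ u) ()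
parse (𝟎 ∷ [])    (𝟐 ∷ u) _  = 𝟐 ∷ u , refl , cut refl λ ()
parse (𝟎 ∷ 𝟏 ∷ w) []      ()
parse (𝟎 ∷ 𝟏 ∷ w) (𝟎 ∷ u) eq with parse w u (∷-injectiveʳ (∷-injectiveʳ eq))
... | r , refl , p = r , refl , Parse-σ*-++ [ 𝟎 ] refl p
parse (𝟎 ∷ 𝟏 ∷ w) (𝟏 ∷ u) ()
parse (𝟎 ∷ 𝟏 ∷ w) (𝟐 ∷ u) eq = ⊥-elim (σ*≢𝟏∷ u (∷-injectiveʳ eq))
parse (𝟎 ∷ 𝟎 ∷ w) []      ()
parse (𝟎 ∷ 𝟎 ∷ w) (𝟎 ∷ u) ()
parse (𝟎 ∷ 𝟎 ∷ w) (𝟏 ∷ u) ()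
parse (𝟎 ∷ 𝟎 ∷ w) (𝟐 ∷ u) eq with parse (𝟎 ∷ w) u (∷-injectiveʳ eq)
... | r , refl , p = r , refl , Parse-σ*-++ [ 𝟐 ] refl p
parse (𝟎 ∷ 𝟐 ∷ w) []      ()
parse (𝟎 ∷ 𝟐 ∷ w) (𝟎 ∷ u) ()
parse (𝟎 ∷ 𝟐 ∷ w) (𝟏 ∷ u) ()
parse (𝟎 ∷ 𝟐 ∷ w) (𝟐 ∷ u) eq with parse (𝟐 ∷ w) u (∷-injectiveʳ eq)
... | r , refl , p = r , refl , Parse-σ*-++ [ 𝟐 ] refl p
parse (𝟏 ∷ w)     u       eq = ⊥-elim (σ*≢𝟏∷ u eq)
parse (𝟐 ∷ w)     []      ()
parse (𝟐 ∷ w)     (𝟎 ∷ u) ()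
parse (𝟐 ∷ w)     (𝟏 ∷ u) eq with parse w u (∷-injectiveʳ eq)
... | r , refl , p = r , refl , Parse-σ*-++ [ 𝟏 ] refl p
parse (𝟐 ∷ w)     (𝟐 ∷ u) ()

desubstitute : ∀ {a} w → IsFactor (a ∷ 𝟎 ∷ w) →
               ∃₂ λ x r → lastσ x ≡ a × IsFactor (x ∷ σ⁻¹ (𝟎 ∷ w) ++ r) × Parse (𝟎 ∷ w) r
desubstitute w f with IsFactor-σ^suc f
... | k , p , s , eq with σ*-split-before-𝟎 (σ^ k [0]) p eq
... | u₁ , x , u₂ , eq₁ , refl , eq₂ with parse (𝟎 ∷ w) u₂ eq₂
... | r , refl , pr = x , r , refl , (k , u₁ , [] , trans eq₁ (cong (u₁ ++_) (sym (++-identityʳ _)))) , pr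

predecessor-𝟎𝟎 : ∀ {a w} → IsFactor (a ∷ 𝟎 ∷ 𝟎 ∷ w) → a ≡ 𝟐
predecessor-𝟎𝟎 {w = w} f with desubstitute (𝟎 ∷ w) f
... | _ , _ , refl , f′ , _ with predecessor-𝟐 f′
... | refl = refl

predecessor-𝟎𝟐 : ∀ {a w} → IsFactor (a ∷ 𝟎 ∷ 𝟐 ∷ w) → a ≡ 𝟐
predecessor-𝟎𝟐 {w = w} f with desubstitute (𝟐 ∷ w) f
... | _ , _ , refl , f′ , _ with predecessor-𝟐 f′
... | refl = refl

LeftSpecial : Word → Set
LeftSpecial w = ∃₂ λ a b → a ≢ b × IsFactor (a ∷ w) × IsFactor (b ∷ w)

forced-predecessor⇒¬LeftSpecial : ∀ {w c} → (∀ {a} → IsFactor (a ∷ w) → a ≡ c) → ¬ LeftSpecial w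
forced-predecessor⇒¬LeftSpecial forced (_ , _ , a≢b , fa , fb) = a≢b (trans (forced fa) (sym (forced fb)))

LeftSpecial⇒IsPrefix : Word → Set
LeftSpecial⇒IsPrefix w = LeftSpecial w → IsPrefix w

infix 4 _⊏_

_⊏_ : Word → Word → Set
v ⊏ w = length v < length w

∷ʳ-⊏-σ*-∷ʳ𝟎 : ∀ v e → (𝟎 ∷ v) ∷ʳ e ⊏ σ* (𝟎 ∷ v) ∷ʳ 𝟎
∷ʳ-⊏-σ*-∷ʳ𝟎 v e =
  s≤s (s≤s (subst₂ _≤_ (sym (length-∷ʳ v e)) (sym (length-∷ʳ (σ* v) 𝟎)) (s≤s (length-σ* v))))

⊏-wellFounded : WellFounded _⊏_
⊏-wellFounded = On.wellFounded length <-wellFounded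

two-non-𝟏-letters : ∀ {c c′ : Letter} → c ≢ 𝟏 → c′ ≢ 𝟏 → c ≢ c′ → c ≡ 𝟐 ⊎ c′ ≡ 𝟐
two-non-𝟏-letters {𝟎} {𝟎} _ _ c≢c′ = ⊥-elim (c≢c′ refl)
two-non-𝟏-letters {𝟎} {𝟏} _ c′≢𝟏 _ = ⊥-elim (c′≢𝟏 refl)
two-non-𝟏-letters {𝟎} {𝟐} _ _ _    = inj₂ refl
two-non-𝟏-letters {𝟏} c≢𝟏 _ _      = ⊥-elim (c≢𝟏 refl)
two-non-𝟏-letters {𝟐} _ _ _        = inj₁ refl

-- If c = c′ the induction hypothesis applies to (0 ∷ v) ∷ʳ c. Otherwise one of c, c′
-- is 2, and as 1 and 2 have different forced predecessors, the letter following the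
-- prefix 0 ∷ v cannot be 1.
cut-prefix-extension : ∀ {v x y c c′ r r′} → WfRec _⊏_ LeftSpecial⇒IsPrefix (σ* (𝟎 ∷ v) ∷ʳ 𝟎) →
                       x ≢ y → c ≢ 𝟏 → c′ ≢ 𝟏 →
                       IsFactor (x ∷ 𝟎 ∷ v ++ c ∷ r) → IsFactor (y ∷ 𝟎 ∷ v ++ c′ ∷ r′) →
                       ∃ λ d → d ≢ 𝟏 × IsPrefix ((𝟎 ∷ v) ∷ʳ d)
cut-prefix-extension {v} {x} {y} {c} {c′} ih x≢y c≢𝟏 c′≢𝟏 fx fy with c ≟ c′
... | yes refl = c , c≢𝟏 , ih (∷ʳ-⊏-σ*-∷ʳ𝟎 v c)
                    (x , y , x≢y , IsFactor-∷ʳ (x ∷ 𝟎 ∷ v) fx , IsFactor-∷ʳ (y ∷ 𝟎 ∷ v) fy)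
... | no c≢c′ =
  let d , pd = IsPrefix-∷ʳ (ih shorter
                 (x , y , x≢y , IsFactor-++⁻ˡ (x ∷ 𝟎 ∷ v) fx , IsFactor-++⁻ˡ (y ∷ 𝟎 ∷ v) fy))
  in d , (λ d≡𝟏 → ∷ʳ𝟏-isFactor⇒∷ʳ𝟐-¬isFactor 𝟎 v
                     (subst (IsFactor ∘ ((𝟎 ∷ v) ∷ʳ_)) d≡𝟏 (IsPrefix⇒IsFactor pd)) ∷ʳ𝟐-isFactor) , pd
  where
  shorter : 𝟎 ∷ v ⊏ σ* (𝟎 ∷ v) ∷ʳ 𝟎
  shorter = <-trans (≤-reflexive (sym (length-∷ʳ (𝟎 ∷ v) c))) (∷ʳ-⊏-σ*-∷ʳ𝟎 v c)
  followed-by : ∀ {z e t} → IsFactor (z ∷ 𝟎 ∷ v ++ e ∷ t) → IsFactor ((𝟎 ∷ v) ∷ʳ e)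
  followed-by {z} f = IsFactor-++⁻ʳ [ z ] (IsFactor-∷ʳ (z ∷ 𝟎 ∷ v) f)
  ∷ʳ𝟐-isFactor : IsFactor ((𝟎 ∷ v) ∷ʳ 𝟐)
  ∷ʳ𝟐-isFactor with two-non-𝟏-letters c≢𝟏 c′≢𝟏 c≢c′
  ... | inj₁ c≡𝟐  = subst (IsFactor ∘ ((𝟎 ∷ v) ∷ʳ_)) c≡𝟐 (followed-by fx)
  ... | inj₂ c′≡𝟐 = subst (IsFactor ∘ ((𝟎 ∷ v) ∷ʳ_)) c′≡𝟐 (followed-by fy)

IsPrefix-σ*-∷ʳ𝟎 : ∀ {v d} → d ≢ 𝟏 → IsPrefix (v ∷ʳ d) → IsPrefix (σ* v ∷ʳ 𝟎)
IsPrefix-σ*-∷ʳ𝟎 {v} {𝟎} _   p = IsPrefix-++⁻ˡ (σ* v ∷ʳ 𝟎)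
  (subst IsPrefix (trans (σ*-++ v [ 𝟎 ]) (sym (++-assoc (σ* v) [ 𝟎 ] [ 𝟏 ]))) (IsPrefix-σ* p))
IsPrefix-σ*-∷ʳ𝟎 {d = 𝟏} d≢𝟏 _ = ⊥-elim (d≢𝟏 refl)
IsPrefix-σ*-∷ʳ𝟎 {v} {𝟐} _   p = subst IsPrefix (σ*-++ v [ 𝟐 ]) (IsPrefix-σ* p)

-- Both occurrences of 0 1 w desubstitute to occurrences of 0 (σ⁻¹ w), preceded by
-- letters x ≠ y because lastσ x = a ≠ b = lastσ y.
leftSpecial-𝟎𝟏⇒isPrefix : ∀ w → WfRec _⊏_ LeftSpecial⇒IsPrefix (𝟎 ∷ 𝟏 ∷ w) →
                           LeftSpecial⇒IsPrefix (𝟎 ∷ 𝟏 ∷ w)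
leftSpecial-𝟎𝟏⇒isPrefix w ih (a , b , a≢b , fa , fb)
  with desubstitute (𝟏 ∷ w) fa | desubstitute (𝟏 ∷ w) fb
... | x , _ , refl , fx , exact e | y , _ , refl , fy , exact _ =
  subst IsPrefix (sym e) (IsPrefix-σ* (subst (WfRec _⊏_ LeftSpecial⇒IsPrefix) e ih (length-σ*-𝟎∷ (σ⁻¹ w))
    (x , y , a≢b ∘ cong lastσ , IsFactor-++⁻ˡ (x ∷ 𝟎 ∷ σ⁻¹ w) fx , IsFactor-++⁻ˡ (y ∷ 𝟎 ∷ σ⁻¹ w) fy)))
... | _ , _ , _ , _ , exact e | _ , _ , _ , _ , cut e′ _ = ⊥-elim (exact≢cut e e′)
... | _ , _ , _ , _ , cut e _ | _ , _ , _ , _ , exact e′ = ⊥-elim (exact≢cut e′ e)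
... | x , _ , refl , fx , cut e c≢𝟏 | y , _ , refl , fy , cut _ c′≢𝟏 =
  let d , d≢𝟏 , pd = cut-prefix-extension (subst (WfRec _⊏_ LeftSpecial⇒IsPrefix) e ih)
                                           (a≢b ∘ cong lastσ) c≢𝟏 c′≢𝟏 fx fy
  in subst IsPrefix (sym e) (IsPrefix-σ*-∷ʳ𝟎 {𝟎 ∷ σ⁻¹ w} d≢𝟏 pd)

leftSpecial⇒isPrefix : ∀ w → LeftSpecial⇒IsPrefix w
leftSpecial⇒isPrefix = WF.All.wfRec ⊏-wellFounded _ LeftSpecial⇒IsPrefix step
  where
  step : ∀ w → WfRec _⊏_ LeftSpecial⇒IsPrefix w → LeftSpecial⇒IsPrefix w
  step []          _  _  = 0 , 𝟎 ∷ [] , refl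
  step (𝟎 ∷ [])    _  _  = 0 , [] , refl
  step (𝟎 ∷ 𝟎 ∷ w) _  ls = ⊥-elim (forced-predecessor⇒¬LeftSpecial predecessor-𝟎𝟎 ls)
  step (𝟎 ∷ 𝟏 ∷ w) ih ls = leftSpecial-𝟎𝟏⇒isPrefix w ih ls
  step (𝟎 ∷ 𝟐 ∷ w) _  ls = ⊥-elim (forced-predecessor⇒¬LeftSpecial predecessor-𝟎𝟐 ls)
  step (𝟏 ∷ w)     _  ls = ⊥-elim (forced-predecessor⇒¬LeftSpecial predecessor-𝟏 ls)
  step (𝟐 ∷ w)     _  ls = ⊥-elim (forced-predecessor⇒¬LeftSpecial predecessor-𝟐 ls)

Factorᵛ : ∀ {i} → Vec Letter i → Set
Factorᵛ u = IsFactor (toList u)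

nonprefix-left-extension : ∀ {i} (w : Vec Letter i) → Factorᵛ w → w ≢ factor 0 i →
                           ∃ λ a → Factorᵛ (a ∷ w)
nonprefix-left-extension w f w≢prefix with IsFactor⇒IsPrefix⊎∷ f
... | inj₁ prefix = ⊥-elim (w≢prefix (isPrefix⇒≡prefix w prefix))
... | inj₂ ext    = ext

leftExtensions : ∀ {i} (w : Vec Letter i) → Factorᵛ w → List (Vec Letter (suc i))
leftExtensions {i} w f with ≡-dec _≟_ w (factor 0 i)
... | yes _        = (𝟎 ∷ w) ∷ (𝟏 ∷ w) ∷ (𝟐 ∷ w) ∷ []
... | no w≢prefix = (proj₁ (nonprefix-left-extension w f w≢prefix) ∷ w) ∷ []

∈-leftExtensions⁻ : ∀ {i} (w : Vec Letter i) f {v} → v ∈ leftExtensions w f → Vec.tail v ≡ w × Factorᵛ v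
∈-leftExtensions⁻ {i} w f v∈ with ≡-dec _≟_ w (factor 0 i) | v∈
... | yes refl | here refl                 = refl , IsPrefix⇒∷-isFactor (prefix-isPrefix i) 𝟎
... | yes refl | there (here refl)         = refl , IsPrefix⇒∷-isFactor (prefix-isPrefix i) 𝟏
... | yes refl | there (there (here refl)) = refl , IsPrefix⇒∷-isFactor (prefix-isPrefix i) 𝟐
... | no w≢prefix | here refl              = refl , proj₂ (nonprefix-left-extension w f w≢prefix)

∈-leftExtensions⁺ : ∀ {i} (w : Vec Letter i) f {a} → Factorᵛ (a ∷ w) → (a ∷ w) ∈ leftExtensions w f
∈-leftExtensions⁺ {i} w f {a} fa with ≡-dec _≟_ w (factor 0 i)
... | yes _ = letter∈ a
  where
  letter∈ : ∀ a → (a ∷ w) ∈ (𝟎 ∷ w) ∷ (𝟏 ∷ w) ∷ (𝟐 ∷ w) ∷ []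
  letter∈ 𝟎 = here refl
  letter∈ 𝟏 = there (here refl)
  letter∈ 𝟐 = there (there (here refl))
... | no w≢prefix with nonprefix-left-extension w f w≢prefix
...   | b , fb with a ≟ b
...     | yes refl = here refl
...     | no a≢b   =
  ⊥-elim (w≢prefix (isPrefix⇒≡prefix w (leftSpecial⇒isPrefix (toList w) (a , b , a≢b , fa , fb))))

leftExtensions-unique : ∀ {i} (w : Vec Letter i) f → Unique (leftExtensions w f)
leftExtensions-unique {i} w f with ≡-dec _≟_ w (factor 0 i)
... | yes _ = ((λ ()) ∷ (λ ()) ∷ []) ∷ ((λ ()) ∷ []) ∷ [] ∷ []
... | no _  = [] ∷ []

length-leftExtensions-prefix : ∀ {i} f → length (leftExtensions (factor 0 i) f) ≡ 3
length-leftExtensions-prefix {i} f with ≡-dec _≟_ (factor 0 i) (factor 0 i)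
... | yes _          = refl
... | no prefix≢prefix = ⊥-elim (prefix≢prefix refl)

length-leftExtensions-nonprefix : ∀ {i} (w : Vec Letter i) f → w ≢ factor 0 i →
                                  length (leftExtensions w f) ≡ 1
length-leftExtensions-nonprefix {i} w f w≢prefix with ≡-dec _≟_ w (factor 0 i)
... | yes w≡prefix = ⊥-elim (w≢prefix w≡prefix)
... | no _         = refl

extendAll : ∀ {i} {L : List (Vec Letter i)} → All Factorᵛ L → List (Vec Letter (suc i))
extendAll []             = []
extendAll (_∷_ {w} f fs) = leftExtensions w f ++ extendAll fs

∈-extendAll⁻ : ∀ {i} {L : List (Vec Letter i)} (fs : All Factorᵛ L) {v} →
               v ∈ extendAll fs → Vec.tail v ∈ L × Factorᵛ v
∈-extendAll⁻ (_∷_ {w} f fs) v∈ with ∈-++⁻ (leftExtensions w f) v∈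
... | inj₁ v∈₁ = let tail≡w , fv = ∈-leftExtensions⁻ w f v∈₁ in here tail≡w , fv
... | inj₂ v∈₂ = let tail∈ , fv = ∈-extendAll⁻ fs v∈₂ in there tail∈ , fv

∈-extendAll⁺ : ∀ {i} {L : List (Vec Letter i)} (fs : All Factorᵛ L) {w a} →
               w ∈ L → Factorᵛ (a ∷ w) → (a ∷ w) ∈ extendAll fs
∈-extendAll⁺ (_∷_ {w} f fs) (here refl) fa = ∈-++⁺ˡ (∈-leftExtensions⁺ w f fa)
∈-extendAll⁺ (_∷_ {w} f fs) (there w∈) fa = ∈-++⁺ʳ (leftExtensions w f) (∈-extendAll⁺ fs w∈ fa)

extendAll-unique : ∀ {i} {L : List (Vec Letter i)} (fs : All Factorᵛ L) →
                   Unique L → Unique (extendAll fs)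
extendAll-unique []             []           = []
extendAll-unique (_∷_ {w} f fs) (w∉ ∷ uniq) =
  Unique.++⁺ (leftExtensions-unique w f) (extendAll-unique fs uniq) disjoint
  where
  disjoint : Disjoint (leftExtensions w f) (extendAll fs)
  disjoint (v∈₁ , v∈₂) =
    All.lookup w∉ (subst (_∈ _) (proj₁ (∈-leftExtensions⁻ w f v∈₁)) (proj₁ (∈-extendAll⁻ fs v∈₂))) refl

length-extendAll-∉ : ∀ {i} {L : List (Vec Letter i)} (fs : All Factorᵛ L) →
                     factor 0 i ∉ L → length (extendAll fs) ≡ length L
length-extendAll-∉ []             _         = refl
length-extendAll-∉ (_∷_ {w} f fs) prefix∉ = trans (length-++ (leftExtensions w f))
  (cong₂ _+_ (length-leftExtensions-nonprefix w f (prefix∉ ∘ here ∘ sym))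
             (length-extendAll-∉ fs (prefix∉ ∘ there)))

length-extendAll-∈ : ∀ {i} {L : List (Vec Letter i)} (fs : All Factorᵛ L) → Unique L →
                     factor 0 i ∈ L → length (extendAll fs) ≡ 2 + length L
length-extendAll-∈ (_∷_ {w} f fs) (w∉ ∷ _) (here refl) = trans (length-++ (leftExtensions w f))
  (cong₂ _+_ (length-leftExtensions-prefix f) (length-extendAll-∉ fs (λ w∈ → All.lookup w∉ w∈ refl)))
length-extendAll-∈ (_∷_ {w} f fs) (w∉ ∷ uniq) (there prefix∈) = trans (length-++ (leftExtensions w f))
  (cong₂ _+_ (length-leftExtensions-nonprefix w f (λ { refl → All.lookup w∉ prefix∈ refl }))
             (length-extendAll-∈ fs uniq prefix∈))

record Factors (i : ℕ) : Set where
  field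
    list    : List (Vec Letter i)
    unique  : Unique list
    length≡ : length list ≡ 2 * i + 1
    ∈⇔      : ∀ u → u ∈ list ⇔ Factorᵛ u

factors : ∀ i → Factors i
factors zero = record
  { list    = [ [] ]
  ; unique  = [] ∷ []
  ; length≡ = refl
  ; ∈⇔      = λ { [] → mk⇔ (λ _ → 0 , [] , [ 𝟎 ] , refl) (λ _ → here refl) }
  }
factors (suc i) = record
  { list    = extendAll fs
  ; unique  = extendAll-unique fs unique
  ; length≡ = begin
      length (extendAll fs)  ≡⟨ length-extendAll-∈ fs unique (listed (IsPrefix⇒IsFactor (prefix-isPrefix i))) ⟩
      2 + length list        ≡⟨ cong (2 +_) length≡ ⟩
      2 + (2 * i + 1)        ≡⟨ cong (_+ 1) (sym (*-suc 2 i)) ⟩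
      2 * suc i + 1          ∎
  ; ∈⇔      = λ { (a ∷ w) → mk⇔ (proj₂ ∘ ∈-extendAll⁻ fs)
                                (λ fa → ∈-extendAll⁺ fs (listed (IsFactor-++⁻ʳ [ a ] fa)) fa) }
  }
  where
  open Factors (factors i)
  open ≡-Reasoning
  listed : ∀ {u} → Factorᵛ u → u ∈ list
  listed = Equivalence.from (∈⇔ _)
  fs : All Factorᵛ list
  fs = All.tabulate (Equivalence.to (∈⇔ _))

theorem13 : (i : ℕ) → Σ (List (Vec Letter i)) (λ L →
              Unique L × length L ≡ 2 * i + 1 ×
              ((u : Vec Letter i) → (u ∈ L) ⇔ ∃ (λ j → factor j i ≡ u)))
theorem13 i = list , unique , length≡ , λ u → ⇔.trans (∈⇔ u) (isFactor⇔factor u)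
  where open Factors (factors i)
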